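{- Let $\kappa$ be an infinite cardinal and $\mathbb{B}$ a complete Boolean algebra. Every $\kappa$-regular filter on $\mathbb{B}$ is $\kappa$-quasiregular.
   Context: A maximal antichain of $\mathbb{B}$ is a set of nonzero pairwise disjoint elements with join $\mathbbm{1}$. A filter $F$ on a complete Boolean algebra $\mathbb{B}$ is $\kappa$-regular iff there exist a family $\{x_\alpha : \alpha<\kappa\}\subseteq F$ and a maximal antichain $A\subset\mathbb{B}$ such that: for every $\alpha<\kappa$ and every $a\in A$, either $a\le x_\alpha$ or $a\wedge x_\alpha=\mathbbm{0}$; and for every $a\in A$ the set $\{\alpha<\kappa : a\le x_\alpha\}$ is finite. A filter $F$ on $\mathbb{B}$ is $\kappa$-quasiregular iff there exists a family $\{x_\alpha : \alpha<\kappa\}\subseteq F$ such that for every infinite $I\subseteq\kappa$, $\bigwedge_{\alpha\in I}x_\alpha=\mathbbm{0}$. -}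

module Defs where

open import Level using (Level; _⊔_) renaming (suc to lsuc)
open import Data.Nat using (ℕ)
open import Data.Product using (Σ; _×_; proj₁)
open import Data.Sum using (_⊎_)
open import Data.List using (List)
open import Data.List.Membership.Propositional using (_∈_)
open import Relation.Nullary using (¬_)
open import Relation.Binary.PropositionalEquality using (_≡_)
open import Function.Definitions using (Injective)
open import Algebra.Lattice.Bundles using (BooleanAlgebra)

record CompleteBooleanAlgebra (c ℓ : Level) : Set (lsuc (c ⊔ ℓ)) where
  field
    booleanAlgebra : BooleanAlgebra c ℓ
  open BooleanAlgebra booleanAlgebra public

  infix 4 _≤_
  _≤_ : Carrier → Carrier → Set ℓ
  x ≤ y = (x ∧ y) ≈ x

  field
    ⋁       : {I : Set c} → (I → Carrier) → Carrier
    ⋁-upper : {I : Set c} (f : I → Carrier) (j : I) → f j ≤ ⋁ f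
    ⋁-least : {I : Set c} (f : I → Carrier) (x : Carrier) → (∀ j → f j ≤ x) → ⋁ f ≤ x
    ⋀       : {I : Set c} → (I → Carrier) → Carrier
    ⋀-lower : {I : Set c} (f : I → Carrier) (j : I) → ⋀ f ≤ f j
    ⋀-great : {I : Set c} (f : I → Carrier) (x : Carrier) → (∀ j → x ≤ f j) → x ≤ ⋀ f

Finite : ∀ {c ℓ} {K : Set c} → (K → Set ℓ) → Set (c ⊔ ℓ)
Finite {K = K} P = Σ (List K) λ L → ∀ α → P α → α ∈ L

Infinite : ∀ {c ℓ} {K : Set c} → (K → Set ℓ) → Set (c ⊔ ℓ)
Infinite {K = K} P = Σ (ℕ → K) λ f → Injective _≡_ _≡_ f × (∀ n → P (f n))

-- An infinite cardinal κ is represented by a type K carrying an injection ℕ → K.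
InfiniteType : ∀ {c} → Set c → Set c
InfiniteType K = Σ (ℕ → K) λ f → Injective _≡_ _≡_ f

module _ {c ℓ : Level} (𝔹 : CompleteBooleanAlgebra c ℓ) where
  open CompleteBooleanAlgebra 𝔹 renaming (¬_ to ∁_)

  record IsFilter (F : Carrier → Set c) : Set (c ⊔ ℓ) where
    field
      ⊤∈F      : F ⊤
      ⊥∉F      : ¬ F ⊥
      upward   : ∀ {x y} → x ≤ y → F x → F y
      ∧-closed : ∀ {x y} → F x → F y → F (x ∧ y)

  record IsMaximalAntichain (A : Carrier → Set c) : Set (c ⊔ ℓ) where
    field
      nonzero  : ∀ a → A a → ¬ (a ≈ ⊥)
      disjoint : ∀ a b → A a → A b → ¬ (a ≈ b) → (a ∧ b) ≈ ⊥
      join-⊤   : ⋁ (λ (p : Σ Carrier A) → proj₁ p) ≈ ⊤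

  IsRegular : (K : Set c) → (Carrier → Set c) → Set (lsuc c ⊔ ℓ)
  IsRegular K F =
    Σ (K → Carrier) λ x → Σ (Carrier → Set c) λ A →
      (∀ α → F (x α)) ×
      IsMaximalAntichain A ×
      (∀ α a → A a → (a ≤ x α) ⊎ ((a ∧ x α) ≈ ⊥)) ×
      (∀ a → A a → Finite (λ α → a ≤ x α))

  IsQuasiregular : (K : Set c) → (Carrier → Set c) → Set (lsuc c ⊔ ℓ)
  IsQuasiregular K F =
    Σ (K → Carrier) λ x →
      (∀ α → F (x α)) ×
      (∀ (I : K → Set c) → Infinite I → ⋀ (λ (p : Σ K I) → x (proj₁ p)) ≈ ⊥)

module Submission where

-- Let {x_α} and the maximal antichain A witness regularity, let I ⊆ κ be
-- infinite (given by an injective sequence f with values in I), and let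
-- m = ⋀_{α ∈ I} x_α.  Fix a ∈ A.  Each x_α either lies above a or is disjoint
-- from a, and only finitely many lie above a; an injective sequence cannot stay
-- inside a finite set, so some α = f n ∈ I has a ∧ x_α = 0, whence a ∧ m = 0.
-- Thus m is disjoint from every member of A, and since ⋁ A = 1 this forces
-- m = 0.

open import Level using (Level)
open import Defs
open import Data.Nat using (ℕ; zero; suc; _<_; s≤s)
open import Data.Nat.Properties using (1+n≰n; m≤n⇒m<n∨m≡n)
open import Data.Fin using (Fin; toℕ)
open import Data.Fin.Properties using (injective⇒≤; toℕ-injective; toℕ<n)
open import Data.Product using (Σ; _,_; proj₁)
open import Data.Sum using (_⊎_; inj₁; inj₂)
open import Data.List using (List; length)
open import Data.List.Membership.Propositional using (_∈_)
open import Data.List.Relation.Unary.Any using (index)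
open import Data.List.Membership.Setoid.Properties using (index-injective)
open import Relation.Nullary using (¬_)
open import Data.Empty using (⊥-elim)
open import Relation.Binary.PropositionalEquality using (_≡_; refl) renaming (setoid to ≡-setoid)
open import Function.Definitions using (Injective)
open import Algebra.Lattice.Bundles using (BooleanAlgebra)
import Algebra.Lattice.Properties.BooleanAlgebra as BooleanAlgebraProperties
import Relation.Binary.Reasoning.Setoid as SetoidReasoning

module BooleanFacts {c ℓ : Level} (B : BooleanAlgebra c ℓ) where
  open BooleanAlgebra B renaming (¬_ to ∁_)
  open BooleanAlgebraProperties B
  open SetoidReasoning setoid

  disjoint-antitone : ∀ {a m y} → (m ∧ y) ≈ m → (a ∧ y) ≈ ⊥ → (a ∧ m) ≈ ⊥
  disjoint-antitone {a} {m} {y} m≤y a∧y≈⊥ = begin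
    a ∧ m        ≈⟨ ∧-congˡ (sym m≤y) ⟩
    a ∧ (m ∧ y)  ≈⟨ sym (∧-assoc a m y) ⟩
    (a ∧ m) ∧ y  ≈⟨ ∧-congʳ (∧-comm a m) ⟩
    (m ∧ a) ∧ y  ≈⟨ ∧-assoc m a y ⟩
    m ∧ (a ∧ y)  ≈⟨ ∧-congˡ a∧y≈⊥ ⟩
    m ∧ ⊥        ≈⟨ ∧-zeroʳ m ⟩
    ⊥            ∎

  disjoint⇒≤∁ : ∀ {a m} → (a ∧ m) ≈ ⊥ → (a ∧ ∁ m) ≈ a
  disjoint⇒≤∁ {a} {m} a∧m≈⊥ = sym (begin
    a                    ≈⟨ sym (∧-identityʳ a) ⟩
    a ∧ ⊤                ≈⟨ ∧-congˡ (sym (∨-complementʳ m)) ⟩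
    a ∧ (m ∨ ∁ m)        ≈⟨ ∧-distribˡ-∨ a m (∁ m) ⟩
    (a ∧ m) ∨ (a ∧ ∁ m)  ≈⟨ ∨-congʳ a∧m≈⊥ ⟩
    ⊥ ∨ (a ∧ ∁ m)        ≈⟨ ∨-identityˡ _ ⟩
    a ∧ ∁ m              ∎)

  ⊤≤∁⇒≈⊥ : ∀ {t m} → t ≈ ⊤ → (t ∧ ∁ m) ≈ t → m ≈ ⊥
  ⊤≤∁⇒≈⊥ {t} {m} t≈⊤ t≤∁m = begin
    m        ≈⟨ sym (∧-identityʳ m) ⟩
    m ∧ ⊤    ≈⟨ ∧-congˡ (sym ∁m≈⊤) ⟩
    m ∧ ∁ m  ≈⟨ ∧-complementʳ m ⟩
    ⊥        ∎
    where
    ∁m≈⊤ : ∁ m ≈ ⊤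
    ∁m≈⊤ = begin
      ∁ m      ≈⟨ sym (∧-identityˡ (∁ m)) ⟩
      ⊤ ∧ ∁ m  ≈⟨ ∧-congʳ (sym t≈⊤) ⟩
      t ∧ ∁ m  ≈⟨ t≤∁m ⟩
      t        ≈⟨ t≈⊤ ⟩
      ⊤        ∎

disjoint-from-cover⇒⊥ : ∀ {c ℓ} (𝔹 : CompleteBooleanAlgebra c ℓ) →
  let open CompleteBooleanAlgebra 𝔹 in
  ∀ {I : Set c} (g : I → Carrier) {m : Carrier} →
  ⋁ g ≈ ⊤ → (∀ i → (g i ∧ m) ≈ ⊥) → m ≈ ⊥
disjoint-from-cover⇒⊥ 𝔹 g ⋁g≈⊤ disjoint =
  ⊤≤∁⇒≈⊥ ⋁g≈⊤ (⋁-least g _ (λ i → disjoint⇒≤∁ (disjoint i)))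
  where
  open CompleteBooleanAlgebra 𝔹
  open BooleanFacts booleanAlgebra

witness-or-prefix : ∀ {b} {P Q : ℕ → Set b} → (∀ n → P n ⊎ Q n) →
  ∀ N → Σ ℕ Q ⊎ (∀ n → n < N → P n)
witness-or-prefix dich zero = inj₂ (λ _ ())
witness-or-prefix {P = P} dich (suc N) with witness-or-prefix dich N | dich N
... | inj₁ found  | _      = inj₁ found
... | inj₂ _      | inj₂ q = inj₁ (N , q)
... | inj₂ prefix | inj₁ p = inj₂ extended
  where
  extended : ∀ n → n < suc N → P n
  extended n (s≤s n≤N) with m≤n⇒m<n∨m≡n n≤N
  ... | inj₁ n<N = prefix n n<N
  ... | inj₂ refl = p

-- Pigeonhole: the first length L + 1 values of an injective sequence cannot
-- all lie in the list L.
injective-escapes-list : ∀ {a} {K : Set a} {f : ℕ → K} → Injective _≡_ _≡_ f →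
  (L : List K) → ¬ (∀ n → n < suc (length L) → f n ∈ L)
injective-escapes-list {K = K} {f} f-inj L inside =
  1+n≰n (injective⇒≤ position-injective)
  where
  membership : (i : Fin (suc (length L))) → f (toℕ i) ∈ L
  membership i = inside (toℕ i) (toℕ<n i)

  position : Fin (suc (length L)) → Fin (length L)
  position i = index (membership i)

  position-injective : Injective _≡_ _≡_ position
  position-injective {i} {j} same = toℕ-injective (f-inj
    (index-injective (≡-setoid K) (membership i) (membership j) same))

injective-leaves-finite : ∀ {a b} {K : Set a} {P Q : K → Set b} {f : ℕ → K} →
  Injective _≡_ _≡_ f → Finite P → (∀ k → P k ⊎ Q k) → Σ ℕ (λ n → Q (f n))
injective-leaves-finite {f = f} f-inj (L , covers) dich
  with witness-or-prefix (λ n → dich (f n)) (suc (length L))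
... | inj₁ found  = found
... | inj₂ prefix = ⊥-elim (injective-escapes-list f-inj L
                      (λ n n<N → covers (f n) (prefix n n<N)))

mainTheorem2 : {c ℓ : Level} (K : Set c) → InfiniteType K →
    (𝔹 : CompleteBooleanAlgebra c ℓ) →
    (F : CompleteBooleanAlgebra.Carrier 𝔹 → Set c) → IsFilter 𝔹 F →
    IsRegular 𝔹 K F → IsQuasiregular 𝔹 K F
mainTheorem2 K _ 𝔹 F _ (x , A , x∈F , antichain , above-or-disjoint , finitely-above) =
  x , x∈F , meet-of-infinite-is-⊥
  where
  open CompleteBooleanAlgebra 𝔹
  open BooleanFacts booleanAlgebra using (disjoint-antitone)
  open IsMaximalAntichain antichain using (join-⊤)

  meet-of-infinite-is-⊥ : ∀ I → Infinite I → ⋀ (λ (p : Σ K I) → x (proj₁ p)) ≈ ⊥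
  meet-of-infinite-is-⊥ I (f , f-inj , f∈I) =
    disjoint-from-cover⇒⊥ 𝔹 proj₁ join-⊤ member-disjoint-from-meet
    where
    meet : Carrier
    meet = ⋀ (λ (p : Σ K I) → x (proj₁ p))

    member-disjoint-from-meet : ∀ (p : Σ Carrier A) → (proj₁ p ∧ meet) ≈ ⊥
    member-disjoint-from-meet (a , a∈A)
      with injective-leaves-finite f-inj (finitely-above a a∈A)
             (λ α → above-or-disjoint α a a∈A)
    ... | n , a∧x≈⊥ = disjoint-antitone (⋀-lower _ (f n , f∈I n)) a∧x≈⊥
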